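{- A Bhargava cube $A$ has all six $2\times2$ cross sections of determinant $1$ if and only if $A\in H(A_n)=\{h A_n: h\in H\}$ for some integer $n$.
   Context: $(F_m)_{m\in\mathbb{Z}}$ are the Fibonacci numbers ($F_0=0$, $F_1=1$, $F_{m+1}=F_m+F_{m-1}$). A Bhargava cube is an integer array $(a_{pqr})_{p,q,r\in\{0,1\}}$; its six $2\times2$ cross sections are obtained by fixing one index: for fixed $p$, $(a_{pqr})_{q,r}$; for fixed $q$, $(a_{pqr})_{p,r}$; for fixed $r$, $(a_{pqr})_{p,q}$ (the remaining lower index labelling rows). $A_n$ is the cube with entries $(A_n)_{pqr}=F_{2(n+p+q+r)-3}$. A triple $(U,V,W)$ of $2\times2$ integer matrices acts on cubes by $(U,V,W)M=M'$ with $m'_{ijk}=\sum_{p,q,r=0}^1U_{ip}V_{jq}W_{kr}m_{pqr}$. Let $I$ be the identity, $J=\begin{pmatrix}0&1\\-1&0\end{pmatrix}$, $Q=\begin{pmatrix}1&0\\0&-1\end{pmatrix}$, and let $H$ be the subgroup of $\mathrm{GL}_2(\mathbb{Z})^3$ generated by $(J,I,I)$, $(I,J,I)$, $(I,I,J)$ and $(Q,Q,Q)$. -}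

module Defs where

open import Data.Nat as ℕ using (ℕ; zero; suc)
open import Data.Integer using (ℤ; +_; -[1+_]; _+_; _*_; -_; _-_)
open import Data.Fin using (Fin; zero; suc)
open import Data.Product using (_×_; _,_)
open import Relation.Binary.PropositionalEquality using (_≡_)

fibℕ : ℕ → ℕ
fibℕ zero = 0
fibℕ (suc zero) = 1
fibℕ (suc (suc n)) = fibℕ (suc n) ℕ.+ fibℕ n

sgn : ℕ → ℤ
sgn zero = + 1
sgn (suc m) = - sgn m

-- Fibonacci numbers on ℤ: F_{-k} = (-1)^{k+1} F_k (the unique extension
-- satisfying F_{m+1} = F_m + F_{m-1} for all m ∈ ℤ)
fib : ℤ → ℤ
fib (+ n) = + fibℕ n
fib -[1+ m ] = sgn m * + fibℕ (suc m)

-- 2×2 integer matrices, indexed (row, column)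
Mat : Set
Mat = Fin 2 → Fin 2 → ℤ

Cube : Set
Cube = Fin 2 → Fin 2 → Fin 2 → ℤ

Σ2 : (Fin 2 → ℤ) → ℤ
Σ2 f = f zero + f (suc zero)

det : Mat → ℤ
det m = m zero zero * m (suc zero) (suc zero) - m zero (suc zero) * m (suc zero) zero

sec₁ sec₂ sec₃ : Cube → Fin 2 → Mat
sec₁ a p q r = a p q r   -- fixed p: rows q, columns r
sec₂ a q p r = a p q r   -- fixed q: rows p, columns r
sec₃ a r p q = a p q r   -- fixed r: rows p, columns q

AllDetsOne : Cube → Set
AllDetsOne a = (i : Fin 2) →
  (det (sec₁ a i) ≡ + 1) × (det (sec₂ a i) ≡ + 1) × (det (sec₃ a i) ≡ + 1)

_≋_ : Cube → Cube → Set
a ≋ b = ∀ i j k → a i j k ≡ b i j k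

toℤ2 : Fin 2 → ℤ
toℤ2 zero = + 0
toℤ2 (suc zero) = + 1

cubeA : ℤ → Cube
cubeA n p q r = fib (+ 2 * (n + toℤ2 p + toℤ2 q + toℤ2 r) - + 3)

Triple : Set
Triple = Mat × Mat × Mat

act : Triple → Cube → Cube
act (U , V , W) m i j k =
  Σ2 λ p → Σ2 λ q → Σ2 λ r → U i p * V j q * W k r * m p q r

matMul : Mat → Mat → Mat
matMul A B i k = Σ2 λ j → A i j * B j k

tripleMul : Triple → Triple → Triple
tripleMul (A , B , C) (A' , B' , C') = matMul A A' , matMul B B' , matMul C C'

mat : ℤ → ℤ → ℤ → ℤ → Mat
mat a b c d zero zero = a
mat a b c d zero (suc zero) = b
mat a b c d (suc zero) zero = c
mat a b c d (suc zero) (suc zero) = d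

I J J⁻¹ Q : Mat
I = mat (+ 1) (+ 0) (+ 0) (+ 1)
J = mat (+ 0) (+ 1) (- + 1) (+ 0)
J⁻¹ = mat (+ 0) (- + 1) (+ 1) (+ 0)
Q = mat (+ 1) (+ 0) (+ 0) (- + 1)

-- the generators of H together with their inverses ((Q,Q,Q) is an involution)
data Gen : Triple → Set where
  g₁ : Gen (J , I , I)
  g₂ : Gen (I , J , I)
  g₃ : Gen (I , I , J)
  g₄ : Gen (Q , Q , Q)
  g₁⁻ : Gen (J⁻¹ , I , I)
  g₂⁻ : Gen (I , J⁻¹ , I)
  g₃⁻ : Gen (I , I , J⁻¹)

-- H = subgroup of GL₂(ℤ)³ generated by the generators: all finite words
data InH : Triple → Set where
  idH : InH (I , I , I)
  stepH : ∀ {g h} → Gen g → InH h → InH (tripleMul g h)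

-- Each generator of H acts along one index, or along all three, by a matrix whose rows are ±(1, 0)
-- or ±(0, 1). Such a matrix permutes the cross sections along its own index up to sign and
-- multiplies the determinants of the other cross sections by its own determinant, so H preserves
-- the condition; A_n satisfies it by Cassini's identity F_{2m-3} F_{2m+1} - F_{2m-1}² = 1.
--
-- Conversely, if all six determinants are 1 then no entry vanishes, and in a face of determinant 1
-- the sign of a diagonal entry is determined by the other three entries, so quarter turns along the
-- three indices make all entries positive. Comparing faces shows that a positive solution is
-- triply symmetric, a_{pqr} depending only on p + q + r, and that its values a, b, d, h along the
-- diagonal satisfy a d = b² + 1 and b h = d² + 1. Vieta jumping shortens such a chain until it is
-- (2, 1, 1, 2) = (F_{-3}, F_{-1}, F_1, F_3), so it consists of consecutive numbers F_{2k-3}.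

module Submission where

open import Defs
open import Data.Integer using (ℤ)
open import Data.Product using (Σ; _×_)
open import Function.Bundles using (_⇔_)

open import Data.Fin using (Fin)
open import Data.Fin.Patterns using (0F; 1F)
open import Data.Integer using (+_; +[1+_]; -[1+_]; -_; _+_; _-_; _*_; ≢-nonZero)
import Data.Integer.Properties as ℤ
open import Data.Integer.Tactic.RingSolver using (solve-∀; solve)
open import Data.List using (_∷_; [])
open import Data.Nat as ℕ using (ℕ; zero; suc)
import Data.Nat.Properties as ℕ
open import Data.Nat.Divisibility using (divides; ∣m+n∣m⇒∣n; n∣m*n; ∣1⇒≡1)
open import Data.Nat.Induction using (<-rec)
import Data.Nat.Tactic.RingSolver as ℕ-Solver
open import Data.Empty using (⊥-elim)
open import Data.Product using (_,_; proj₁; proj₂; ∃; map₂; uncurry)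
open import Data.Sum using (_⊎_; inj₁; inj₂; fromInj₂)
open import Function.Base using (_∘_)
open import Function.Bundles using (mk⇔)
open import Relation.Binary.Bundles using (Setoid)
open import Relation.Binary.Definitions using (tri<; tri≈; tri>)
open import Relation.Nullary using (yes; no)
open import Relation.Binary.Structures using (IsEquivalence)
import Relation.Binary.Reasoning.Setoid
open import Relation.Binary.PropositionalEquality
  using (_≡_; _≢_; refl; sym; trans; subst; subst₂; cong; cong₂; module ≡-Reasoning)

variable
  X Y C C′ : Cube
  d₁ d₂ d₃ : ℤ

≋-isEquivalence : IsEquivalence _≋_
≋-isEquivalence = record
  { refl  = λ _ _ _ → refl
  ; sym   = λ e i j k → sym (e i j k)
  ; trans = λ e f i j k → trans (e i j k) (f i j k)
  }

≋-setoid : Setoid _ _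
≋-setoid = record { isEquivalence = ≋-isEquivalence }

open IsEquivalence ≋-isEquivalence
  using () renaming (sym to ≋-sym; trans to ≋-trans)

module ≋-Reasoning = Relation.Binary.Reasoning.Setoid ≋-setoid

-- The action of triples of matrices by mode products

infixr 25 _·₁_ _·₂_ _·₃_

_·₁_ _·₂_ _·₃_ : Mat → Cube → Cube
(U ·₁ C) i q r = Σ2 λ p → U i p * C p q r
(V ·₂ C) p j r = Σ2 λ q → V j q * C p q r
(W ·₃ C) p q k = Σ2 λ r → W k r * C p q r

Σ2-cong : {f f′ : Fin 2 → ℤ} → (∀ p → f p ≡ f′ p) → Σ2 f ≡ Σ2 f′
Σ2-cong e = cong₂ _+_ (e 0F) (e 1F)

·₁-cong : ∀ U → C ≋ C′ → U ·₁ C ≋ U ·₁ C′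
·₁-cong U e i q r = Σ2-cong λ p → cong (U i p *_) (e p q r)

·₂-cong : ∀ V → C ≋ C′ → V ·₂ C ≋ V ·₂ C′
·₂-cong V e p j r = Σ2-cong λ q → cong (V j q *_) (e p q r)

·₃-cong : ∀ W → C ≋ C′ → W ·₃ C ≋ W ·₃ C′
·₃-cong W e p q k = Σ2-cong λ r → cong (W k r *_) (e p q r)

act-cong : ∀ h → C ≋ C′ → act h C ≋ act h C′
act-cong (U , V , W) e i j k =
  Σ2-cong λ p → Σ2-cong λ q → Σ2-cong λ r → cong (U i p * V j q * W k r *_) (e p q r)

*-distribˡ-Σ2 : ∀ x (f : Fin 2 → ℤ) → x * Σ2 f ≡ Σ2 (λ p → x * f p)
*-distribˡ-Σ2 x f = ℤ.*-distribˡ-+ x (f 0F) (f 1F)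

act-nested : ∀ U V W C → act (U , V , W) C ≋ U ·₁ V ·₂ W ·₃ C
act-nested U V W C i j k = Σ2-cong λ p → begin
  Σ2 (λ q → Σ2 (λ r → U i p * V j q * W k r * C p q r))
    ≡⟨ Σ2-cong (λ q → Σ2-cong (λ r → *-assoc₄ (U i p) (V j q) (W k r) (C p q r))) ⟩
  Σ2 (λ q → Σ2 (λ r → U i p * (V j q * (W k r * C p q r))))
    ≡⟨ Σ2-cong (λ q → *-distribˡ-Σ2 (U i p) (λ r → V j q * (W k r * C p q r))) ⟨
  Σ2 (λ q → U i p * Σ2 (λ r → V j q * (W k r * C p q r)))
    ≡⟨ *-distribˡ-Σ2 (U i p) (λ q → Σ2 (λ r → V j q * (W k r * C p q r))) ⟨
  U i p * Σ2 (λ q → Σ2 (λ r → V j q * (W k r * C p q r)))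
    ≡⟨ cong (U i p *_) (Σ2-cong λ q → *-distribˡ-Σ2 (V j q) (λ r → W k r * C p q r)) ⟨
  U i p * Σ2 (λ q → V j q * Σ2 (λ r → W k r * C p q r)) ∎
  where
  open ≡-Reasoning
  *-assoc₄ : ∀ a b c d → a * b * c * d ≡ a * (b * (c * d))
  *-assoc₄ = solve-∀

Σ2-matMul : ∀ (u : Fin 2 → ℤ) (M : Mat) (c : Fin 2 → ℤ) →
  Σ2 (λ p → Σ2 (λ j → u j * M j p) * c p) ≡ Σ2 (λ j → u j * Σ2 (λ p → M j p * c p))
Σ2-matMul u M c = lemma (u 0F) (u 1F) (M 0F 0F) (M 0F 1F) (M 1F 0F) (M 1F 1F) (c 0F) (c 1F)
  where
  lemma : ∀ u₀ u₁ m₀₀ m₀₁ m₁₀ m₁₁ c₀ c₁ →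
    (u₀ * m₀₀ + u₁ * m₁₀) * c₀ + (u₀ * m₀₁ + u₁ * m₁₁) * c₁
      ≡ u₀ * (m₀₀ * c₀ + m₀₁ * c₁) + u₁ * (m₁₀ * c₀ + m₁₁ * c₁)
  lemma = solve-∀

Σ2-interchange : ∀ (u v : Fin 2 → ℤ) (c : Mat) →
  Σ2 (λ p → u p * Σ2 (λ q → v q * c p q)) ≡ Σ2 (λ q → v q * Σ2 (λ p → u p * c p q))
Σ2-interchange u v c = lemma (u 0F) (u 1F) (v 0F) (v 1F) (c 0F 0F) (c 0F 1F) (c 1F 0F) (c 1F 1F)
  where
  lemma : ∀ u₀ u₁ v₀ v₁ c₀₀ c₀₁ c₁₀ c₁₁ →
    u₀ * (v₀ * c₀₀ + v₁ * c₀₁) + u₁ * (v₀ * c₁₀ + v₁ * c₁₁)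
      ≡ v₀ * (u₀ * c₀₀ + u₁ * c₁₀) + v₁ * (u₀ * c₀₁ + u₁ * c₁₁)
  lemma = solve-∀

·₁-matMul : ∀ U U′ C → matMul U U′ ·₁ C ≋ U ·₁ U′ ·₁ C
·₁-matMul U U′ C i q r = Σ2-matMul (U i) U′ (λ p → C p q r)

·₂-matMul : ∀ V V′ C → matMul V V′ ·₂ C ≋ V ·₂ V′ ·₂ C
·₂-matMul V V′ C p j r = Σ2-matMul (V j) V′ (λ q → C p q r)

·₃-matMul : ∀ W W′ C → matMul W W′ ·₃ C ≋ W ·₃ W′ ·₃ C
·₃-matMul W W′ C p q k = Σ2-matMul (W k) W′ (C p q)

·₁-·₂-comm : ∀ U V C → U ·₁ V ·₂ C ≋ V ·₂ U ·₁ C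
·₁-·₂-comm U V C i j r = Σ2-interchange (U i) (V j) (λ p q → C p q r)

·₁-·₃-comm : ∀ U W C → U ·₁ W ·₃ C ≋ W ·₃ U ·₁ C
·₁-·₃-comm U W C i q k = Σ2-interchange (U i) (W k) (λ p r → C p q r)

·₂-·₃-comm : ∀ V W C → V ·₂ W ·₃ C ≋ W ·₃ V ·₂ C
·₂-·₃-comm V W C p j k = Σ2-interchange (V j) (W k) (C p)

act-tripleMul : ∀ g h C → act (tripleMul g h) C ≋ act g (act h C)
act-tripleMul (U , V , W) (U′ , V′ , W′) C = begin
  act (matMul U U′ , matMul V V′ , matMul W W′) C
    ≈⟨ act-nested (matMul U U′) (matMul V V′) (matMul W W′) C ⟩
  matMul U U′ ·₁ matMul V V′ ·₂ matMul W W′ ·₃ C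
    ≈⟨ ·₁-matMul U U′ (matMul V V′ ·₂ matMul W W′ ·₃ C) ⟩
  U ·₁ U′ ·₁ matMul V V′ ·₂ matMul W W′ ·₃ C
    ≈⟨ ·₁-cong U (·₁-cong U′ (·₂-matMul V V′ (matMul W W′ ·₃ C))) ⟩
  U ·₁ U′ ·₁ V ·₂ V′ ·₂ matMul W W′ ·₃ C
    ≈⟨ ·₁-cong U (·₁-cong U′ (·₂-cong V (·₂-cong V′ (·₃-matMul W W′ C)))) ⟩
  U ·₁ U′ ·₁ V ·₂ V′ ·₂ W ·₃ W′ ·₃ C
    ≈⟨ ·₁-cong U (·₁-·₂-comm U′ V (V′ ·₂ W ·₃ W′ ·₃ C)) ⟩
  U ·₁ V ·₂ U′ ·₁ V′ ·₂ W ·₃ W′ ·₃ C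
    ≈⟨ ·₁-cong U (·₂-cong V (·₁-cong U′ (·₂-·₃-comm V′ W (W′ ·₃ C)))) ⟩
  U ·₁ V ·₂ U′ ·₁ W ·₃ V′ ·₂ W′ ·₃ C
    ≈⟨ ·₁-cong U (·₂-cong V (·₁-·₃-comm U′ W (V′ ·₂ W′ ·₃ C))) ⟩
  U ·₁ V ·₂ W ·₃ U′ ·₁ V′ ·₂ W′ ·₃ C
    ≈⟨ ·₁-cong U (·₂-cong V (·₃-cong W (act-nested U′ V′ W′ C))) ⟨
  U ·₁ V ·₂ W ·₃ act (U′ , V′ , W′) C
    ≈⟨ act-nested U V W (act (U′ , V′ , W′) C) ⟨
  act (U , V , W) (act (U′ , V′ , W′) C) ∎
  where open ≋-Reasoning

I-row₀ : ∀ x y → + 1 * x + + 0 * y ≡ x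
I-row₀ = solve-∀

I-row₁ : ∀ x y → + 0 * x + + 1 * y ≡ y
I-row₁ = solve-∀

I·₁ : ∀ C → I ·₁ C ≋ C
I·₁ C 0F q r = I-row₀ (C 0F q r) (C 1F q r)
I·₁ C 1F q r = I-row₁ (C 0F q r) (C 1F q r)

I·₂ : ∀ C → I ·₂ C ≋ C
I·₂ C p 0F r = I-row₀ (C p 0F r) (C p 1F r)
I·₂ C p 1F r = I-row₁ (C p 0F r) (C p 1F r)

I·₃ : ∀ C → I ·₃ C ≋ C
I·₃ C p q 0F = I-row₀ (C p q 0F) (C p q 1F)
I·₃ C p q 1F = I-row₁ (C p q 0F) (C p q 1F)

act-along₁ : ∀ U C → act (U , I , I) C ≋ U ·₁ C
act-along₁ U C = ≋-trans (act-nested U I I C) (·₁-cong U (≋-trans (·₂-cong I (I·₃ C)) (I·₂ C)))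

act-along₂ : ∀ V C → act (I , V , I) C ≋ V ·₂ C
act-along₂ V C = ≋-trans (act-nested I V I C) (≋-trans (I·₁ (V ·₂ I ·₃ C)) (·₂-cong V (I·₃ C)))

act-along₃ : ∀ W C → act (I , I , W) C ≋ W ·₃ C
act-along₃ W C = ≋-trans (act-nested I I W C) (≋-trans (I·₁ (I ·₂ W ·₃ C)) (I·₂ (W ·₃ C)))

act-identity : ∀ C → act (I , I , I) C ≋ C
act-identity C = ≋-trans (act-along₁ I C) (I·₁ C)

-- Determinants of cross sections

det-cong : {M N : Mat} → (∀ i j → M i j ≡ N i j) → det M ≡ det N
det-cong e = cong₂ _-_ (cong₂ _*_ (e 0F 0F) (e 1F 1F)) (cong₂ _*_ (e 0F 1F) (e 1F 0F))

det-matMul : ∀ A B → det (matMul A B) ≡ det A * det B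
det-matMul A B =
  lemma (A 0F 0F) (A 0F 1F) (A 1F 0F) (A 1F 1F) (B 0F 0F) (B 0F 1F) (B 1F 0F) (B 1F 1F)
  where
  lemma : ∀ a₀₀ a₀₁ a₁₀ a₁₁ b₀₀ b₀₁ b₁₀ b₁₁ →
    (a₀₀ * b₀₀ + a₀₁ * b₁₀) * (a₁₀ * b₀₁ + a₁₁ * b₁₁)
      - (a₀₀ * b₀₁ + a₀₁ * b₁₁) * (a₁₀ * b₀₀ + a₁₁ * b₁₀)
      ≡ (a₀₀ * a₁₁ - a₀₁ * a₁₀) * (b₀₀ * b₁₁ - b₀₁ * b₁₀)
  lemma = solve-∀

det-mul-transpose : ∀ M B → det (λ i j → Σ2 λ k → B j k * M i k) ≡ det B * det M
det-mul-transpose M B =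
  lemma (M 0F 0F) (M 0F 1F) (M 1F 0F) (M 1F 1F) (B 0F 0F) (B 0F 1F) (B 1F 0F) (B 1F 1F)
  where
  lemma : ∀ m₀₀ m₀₁ m₁₀ m₁₁ b₀₀ b₀₁ b₁₀ b₁₁ →
    (b₀₀ * m₀₀ + b₀₁ * m₀₁) * (b₁₀ * m₁₀ + b₁₁ * m₁₁)
      - (b₁₀ * m₀₀ + b₁₁ * m₀₁) * (b₀₀ * m₁₀ + b₀₁ * m₁₁)
      ≡ (b₀₀ * b₁₁ - b₀₁ * b₁₀) * (m₀₀ * m₁₁ - m₀₁ * m₁₀)
  lemma = solve-∀

mixedDet : Mat → Mat → ℤ
mixedDet M N = M 0F 0F * N 1F 1F + N 0F 0F * M 1F 1F - M 0F 1F * N 1F 0F - N 0F 1F * M 1F 0F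

det-combination : ∀ x y M N →
  det (λ i j → x * M i j + y * N i j) ≡ x * x * det M + y * y * det N + x * y * mixedDet M N
det-combination x y M N =
  lemma x y (M 0F 0F) (M 0F 1F) (M 1F 0F) (M 1F 1F) (N 0F 0F) (N 0F 1F) (N 1F 0F) (N 1F 1F)
  where
  lemma : ∀ x y m₀₀ m₀₁ m₁₀ m₁₁ n₀₀ n₀₁ n₁₀ n₁₁ →
    (x * m₀₀ + y * n₀₀) * (x * m₁₁ + y * n₁₁) - (x * m₀₁ + y * n₀₁) * (x * m₁₀ + y * n₁₀)
      ≡ x * x * (m₀₀ * m₁₁ - m₀₁ * m₁₀) + y * y * (n₀₀ * n₁₁ - n₀₁ * n₁₀)
        + x * y * (m₀₀ * n₁₁ + n₀₀ * m₁₁ - m₀₁ * n₁₀ - n₀₁ * m₁₀)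
  lemma = solve-∀

-- x * y = 0 and x² + y² = 1 hold exactly for (x, y) = ±(1, 0) and ±(0, 1).
UnitRow : ℤ → ℤ → Set
UnitRow x y = x * y ≡ + 0 × x * x + y * y ≡ + 1

UnitRows : Mat → Set
UnitRows U = ∀ i → UnitRow (U i 0F) (U i 1F)

det-unit-combination : ∀ {d} x y M N → UnitRow x y → det M ≡ d → det N ≡ d →
  det (λ i j → x * M i j + y * N i j) ≡ d
det-unit-combination {d} x y M N (xy≡0 , x²+y²≡1) detM≡d detN≡d = begin
  det (λ i j → x * M i j + y * N i j)
    ≡⟨ det-combination x y M N ⟩
  x * x * det M + y * y * det N + x * y * mixedDet M N
    ≡⟨ cong₂ (λ s t → x * x * s + y * y * t + x * y * mixedDet M N) detM≡d detN≡d ⟩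
  x * x * d + y * y * d + x * y * mixedDet M N
    ≡⟨ cong (λ t → x * x * d + y * y * d + t * mixedDet M N) xy≡0 ⟩
  x * x * d + y * y * d + + 0 * mixedDet M N
    ≡⟨ regroup (x * x) (y * y) d (mixedDet M N) ⟩
  (x * x + y * y) * d
    ≡⟨ cong (_* d) x²+y²≡1 ⟩
  + 1 * d
    ≡⟨ ℤ.*-identityˡ d ⟩
  d ∎
  where
  open ≡-Reasoning
  regroup : ∀ s t d m → s * d + t * d + + 0 * m ≡ (s + t) * d
  regroup = solve-∀

record SectionDets (d₁ d₂ d₃ : ℤ) (C : Cube) : Set where
  field
    sec₁-det : ∀ i → det (sec₁ C i) ≡ d₁
    sec₂-det : ∀ i → det (sec₂ C i) ≡ d₂
    sec₃-det : ∀ i → det (sec₃ C i) ≡ d₃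
open SectionDets

Unimodular : Cube → Set
Unimodular = SectionDets (+ 1) (+ 1) (+ 1)

AllDetsOne⇒Unimodular : AllDetsOne C → Unimodular C
AllDetsOne⇒Unimodular dets = record
  { sec₁-det = λ i → proj₁ (dets i)
  ; sec₂-det = λ i → proj₁ (proj₂ (dets i))
  ; sec₃-det = λ i → proj₂ (proj₂ (dets i))
  }

Unimodular⇒AllDetsOne : Unimodular C → AllDetsOne C
Unimodular⇒AllDetsOne dets i = sec₁-det dets i , sec₂-det dets i , sec₃-det dets i

SectionDets-cong : X ≋ Y → SectionDets d₁ d₂ d₃ Y → SectionDets d₁ d₂ d₃ X
SectionDets-cong X≋Y dets = record
  { sec₁-det = λ i → trans (det-cong λ q r → X≋Y i q r) (sec₁-det dets i)
  ; sec₂-det = λ i → trans (det-cong λ p r → X≋Y p i r) (sec₂-det dets i)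
  ; sec₃-det = λ i → trans (det-cong λ p q → X≋Y p q i) (sec₃-det dets i)
  }

·₁-SectionDets : ∀ U → UnitRows U → SectionDets d₁ d₂ d₃ C →
  SectionDets d₁ (det U * d₂) (det U * d₃) (U ·₁ C)
·₁-SectionDets {C = C} U unit dets = record
  { sec₁-det = λ i → det-unit-combination (U i 0F) (U i 1F) (sec₁ C 0F) (sec₁ C 1F)
                       (unit i) (sec₁-det dets 0F) (sec₁-det dets 1F)
  ; sec₂-det = λ i → trans (det-matMul U (sec₂ C i)) (cong (det U *_) (sec₂-det dets i))
  ; sec₃-det = λ i → trans (det-matMul U (sec₃ C i)) (cong (det U *_) (sec₃-det dets i))
  }

·₂-SectionDets : ∀ V → UnitRows V → SectionDets d₁ d₂ d₃ C →
  SectionDets (det V * d₁) d₂ (det V * d₃) (V ·₂ C)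
·₂-SectionDets {C = C} V unit dets = record
  { sec₁-det = λ i → trans (det-matMul V (sec₁ C i)) (cong (det V *_) (sec₁-det dets i))
  ; sec₂-det = λ i → det-unit-combination (V i 0F) (V i 1F) (sec₂ C 0F) (sec₂ C 1F)
                       (unit i) (sec₂-det dets 0F) (sec₂-det dets 1F)
  ; sec₃-det = λ i → trans (det-mul-transpose (sec₃ C i) V) (cong (det V *_) (sec₃-det dets i))
  }

·₃-SectionDets : ∀ W → UnitRows W → SectionDets d₁ d₂ d₃ C →
  SectionDets (det W * d₁) (det W * d₂) d₃ (W ·₃ C)
·₃-SectionDets {C = C} W unit dets = record
  { sec₁-det = λ i → trans (det-mul-transpose (sec₁ C i) W) (cong (det W *_) (sec₁-det dets i))
  ; sec₂-det = λ i → trans (det-mul-transpose (sec₂ C i) W) (cong (det W *_) (sec₂-det dets i))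
  ; sec₃-det = λ i → det-unit-combination (W i 0F) (W i 1F) (sec₃ C 0F) (sec₃ C 1F)
                       (unit i) (sec₃-det dets 0F) (sec₃-det dets 1F)
  }

act-SectionDets : ∀ U V W → UnitRows U → UnitRows V → UnitRows W → SectionDets d₁ d₂ d₃ C →
  SectionDets (det V * (det W * d₁)) (det U * (det W * d₂)) (det U * (det V * d₃))
              (act (U , V , W) C)
act-SectionDets {C = C} U V W unitU unitV unitW dets =
  SectionDets-cong (act-nested U V W C)
    (·₁-SectionDets U unitU (·₂-SectionDets V unitV (·₃-SectionDets W unitW dets)))

unitRows-I : UnitRows I
unitRows-I 0F = refl , refl
unitRows-I 1F = refl , refl

unitRows-J : UnitRows J
unitRows-J 0F = refl , refl
unitRows-J 1F = refl , refl

unitRows-J⁻¹ : UnitRows J⁻¹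
unitRows-J⁻¹ 0F = refl , refl
unitRows-J⁻¹ 1F = refl , refl

unitRows-Q : UnitRows Q
unitRows-Q 0F = refl , refl
unitRows-Q 1F = refl , refl

Gen-Unimodular : ∀ {g} → Gen g → Unimodular C → Unimodular (act g C)
Gen-Unimodular g₁ dets  = act-SectionDets J I I unitRows-J unitRows-I unitRows-I dets
Gen-Unimodular g₂ dets  = act-SectionDets I J I unitRows-I unitRows-J unitRows-I dets
Gen-Unimodular g₃ dets  = act-SectionDets I I J unitRows-I unitRows-I unitRows-J dets
Gen-Unimodular g₄ dets  = act-SectionDets Q Q Q unitRows-Q unitRows-Q unitRows-Q dets
Gen-Unimodular g₁⁻ dets = act-SectionDets J⁻¹ I I unitRows-J⁻¹ unitRows-I unitRows-I dets
Gen-Unimodular g₂⁻ dets = act-SectionDets I J⁻¹ I unitRows-I unitRows-J⁻¹ unitRows-I dets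
Gen-Unimodular g₃⁻ dets = act-SectionDets I I J⁻¹ unitRows-I unitRows-I unitRows-J⁻¹ dets

InH-Unimodular : ∀ {h} → InH h → Unimodular C → Unimodular (act h C)
InH-Unimodular idH dets = act-SectionDets I I I unitRows-I unitRows-I unitRows-I dets
InH-Unimodular {C = C} (stepH {g} {h} gen h∈H) dets =
  SectionDets-cong (act-tripleMul g h C) (Gen-Unimodular gen (InH-Unimodular h∈H dets))

-- Odd-indexed Fibonacci numbers and Cassini's identity

fib-rec : ∀ m → fib (m + + 2) ≡ fib (m + + 1) + fib m
fib-rec (+ n) =
  trans (cong (λ k → + fibℕ k) (ℕ.+-comm n 2)) (cong (λ k → + fibℕ k + + fibℕ n) (ℕ.+-comm 1 n))
fib-rec -[1+ 0 ] = refl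
fib-rec -[1+ 1 ] = refl
fib-rec -[1+ suc (suc n) ] = lemma (sgn n) (+ fibℕ (suc n)) (+ fibℕ n)
  where
  lemma : ∀ s x y → s * x ≡ - s * (x + y) + - - s * (x + y + x)
  lemma = solve-∀

fib-rec-from : ∀ m i → fib (m + (i + + 2)) ≡ fib (m + (i + + 1)) + fib (m + i)
fib-rec-from m i rewrite sym (ℤ.+-assoc m i (+ 2)) | sym (ℤ.+-assoc m i (+ 1)) = fib-rec (m + i)

fib-skip : ∀ m → fib (m + + 4) ≡ + 3 * fib (m + + 2) - fib m
fib-skip m = skip (fib-rec m) (fib-rec-from m (+ 1)) (fib-rec-from m (+ 2))
  where
  skip : ∀ {x₀ x₁ x₂ x₃ x₄} →
    x₂ ≡ x₁ + x₀ → x₃ ≡ x₂ + x₁ → x₄ ≡ x₃ + x₂ → x₄ ≡ + 3 * x₂ - x₀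
  skip {x₀} {x₁} refl refl refl = solve (x₀ ∷ x₁ ∷ [])

oddFib : ℤ → ℤ
oddFib k = fib (+ 2 * k - + 3)

oddFib-rec : ∀ k → oddFib (k + + 2) ≡ + 3 * oddFib (k + + 1) - oddFib k
oddFib-rec k = begin
  fib (+ 2 * (k + + 2) - + 3)  ≡⟨ cong fib (index k (+ 2)) ⟩
  fib (m + + 4)                ≡⟨ fib-skip m ⟩
  + 3 * fib (m + + 2) - fib m  ≡⟨ cong (λ t → + 3 * fib t - fib m) (index k (+ 1)) ⟨
  + 3 * oddFib (k + + 1) - oddFib k ∎
  where
  open ≡-Reasoning
  m = + 2 * k - + 3
  index : ∀ k i → + 2 * (k + i) - + 3 ≡ + 2 * k - + 3 + + 2 * i
  index = solve-∀

cassini-invariant : ∀ {x₀ x₁ x₂ x₃} → x₂ ≡ + 3 * x₁ - x₀ → x₃ ≡ + 3 * x₂ - x₁ →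
  x₁ * x₃ - x₂ * x₂ ≡ x₀ * x₂ - x₁ * x₁
cassini-invariant {x₀} {x₁} refl refl = solve (x₀ ∷ x₁ ∷ [])

cassiniAt : ℤ → ℤ
cassiniAt k = oddFib k * oddFib (k + + 2) - oddFib (k + + 1) * oddFib (k + + 1)

cassiniAt-step : ∀ k → cassiniAt (k + + 1) ≡ cassiniAt k
cassiniAt-step k =
  trans (cong (λ t → oddFib (k + + 1) * oddFib (k + + 1 + + 2) - oddFib t * oddFib t) k+1+1≡k+2)
        (cassini-invariant (oddFib-rec k) rec₁)
  where
  k+1+1≡k+2 = ℤ.+-assoc k (+ 1) (+ 1)
  rec₁ : oddFib (k + + 1 + + 2) ≡ + 3 * oddFib (k + + 2) - oddFib (k + + 1)
  rec₁ = trans (oddFib-rec (k + + 1)) (cong (λ t → + 3 * oddFib t - oddFib (k + + 1)) k+1+1≡k+2)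

cassini : ∀ k → oddFib k * oddFib (k + + 2) - oddFib (k + + 1) * oddFib (k + + 1) ≡ + 1
cassini (+ zero)     = refl
cassini +[1+ n ]     =
  trans (cong (λ j → cassiniAt (+ j)) (ℕ.+-comm 1 n)) (trans (cassiniAt-step (+ n)) (cassini (+ n)))
cassini -[1+ zero ]  = trans (sym (cassiniAt-step -[1+ zero ])) (cassini (+ zero))
cassini -[1+ suc n ] = trans (sym (cassiniAt-step -[1+ suc n ])) (cassini -[1+ n ])

cassini-from : ∀ n k → oddFib (n + k) * oddFib (n + (k + + 2))
                         - oddFib (n + (k + + 1)) * oddFib (n + (k + + 1)) ≡ + 1
cassini-from n k rewrite sym (ℤ.+-assoc n k (+ 2)) | sym (ℤ.+-assoc n k (+ 1)) = cassini (n + k)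

x-y≡1⇒x≡1+y : ∀ x y → x - y ≡ + 1 → x ≡ + 1 + y
x-y≡1⇒x≡1+y x y e = trans (lemma x y) (cong (_+ y) e)
  where
  lemma : ∀ x y → x ≡ (x - y) + y
  lemma = solve-∀

cassini⁺ : ∀ n k → oddFib (n + k) * oddFib (n + (k + + 2))
                     ≡ + 1 + oddFib (n + (k + + 1)) * oddFib (n + (k + + 1))
cassini⁺ n k = x-y≡1⇒x≡1+y _ _ (cassini-from n k)

-- The orbits of the cubes A_n

symCube : (ℤ → ℤ) → Cube
symCube x p q r = x (toℤ2 p + toℤ2 q + toℤ2 r)

Unimodular-symCube : ∀ x →
  x (+ 0) * x (+ 2) - x (+ 1) * x (+ 1) ≡ + 1 →
  x (+ 1) * x (+ 3) - x (+ 2) * x (+ 2) ≡ + 1 →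
  Unimodular (symCube x)
Unimodular-symCube x c₀ c₁ = record
  { sec₁-det = λ { 0F → c₀ ; 1F → c₁ }
  ; sec₂-det = λ { 0F → c₀ ; 1F → c₁ }
  ; sec₃-det = λ { 0F → c₀ ; 1F → c₁ }
  }

cubeA-symCube : ∀ n → cubeA n ≋ symCube (λ k → oddFib (n + k))
cubeA-symCube n p q r =
  cong oddFib (trans (cong (_+ c) (ℤ.+-assoc n a b)) (ℤ.+-assoc n (a + b) c))
  where
  a = toℤ2 p
  b = toℤ2 q
  c = toℤ2 r

Unimodular-cubeA : ∀ n → Unimodular (cubeA n)
Unimodular-cubeA n =
  SectionDets-cong (cubeA-symCube n)
    (Unimodular-symCube (λ k → oddFib (n + k)) (cassini-from n (+ 0)) (cassini-from n (+ 1)))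

InOrbit : Cube → Set
InOrbit X = Σ ℤ λ n → Σ Triple λ h → InH h × (X ≋ act h (cubeA n))

InOrbit⇒Unimodular : ∀ X → InOrbit X → Unimodular X
InOrbit⇒Unimodular X (n , h , h∈H , X≋hAₙ) =
  SectionDets-cong X≋hAₙ (InH-Unimodular h∈H (Unimodular-cubeA n))

InOrbit-Gen : ∀ {g} → Gen g → X ≋ act g Y → InOrbit Y → InOrbit X
InOrbit-Gen {X = X} {Y = Y} {g = g} gen X≋gY (n , h , h∈H , Y≋hA) =
  n , tripleMul g h , stepH gen h∈H , (begin
    X                           ≈⟨ X≋gY ⟩
    act g Y                     ≈⟨ act-cong g Y≋hA ⟩
    act g (act h (cubeA n))     ≈⟨ act-tripleMul g h (cubeA n) ⟨
    act (tripleMul g h) (cubeA n) ∎)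
  where open ≋-Reasoning

turn₁ turn₂ turn₃ : Cube → Cube
turn₁ X 0F q r = - X 1F q r
turn₁ X 1F q r = X 0F q r
turn₂ X p 0F r = - X p 1F r
turn₂ X p 1F r = X p 0F r
turn₃ X p q 0F = - X p q 1F
turn₃ X p q 1F = X p q 0F

J⁻¹-row₀ : ∀ x y → + 0 * x + - + 1 * y ≡ - y
J⁻¹-row₀ = solve-∀

J-row₁ : ∀ x y → - + 1 * - x + + 0 * y ≡ x
J-row₁ = solve-∀

J⁻¹·₁ : ∀ X → J⁻¹ ·₁ X ≋ turn₁ X
J⁻¹·₁ X 0F q r = J⁻¹-row₀ (X 0F q r) (X 1F q r)
J⁻¹·₁ X 1F q r = I-row₀ (X 0F q r) (X 1F q r)

J⁻¹·₂ : ∀ X → J⁻¹ ·₂ X ≋ turn₂ X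
J⁻¹·₂ X p 0F r = J⁻¹-row₀ (X p 0F r) (X p 1F r)
J⁻¹·₂ X p 1F r = I-row₀ (X p 0F r) (X p 1F r)

J⁻¹·₃ : ∀ X → J⁻¹ ·₃ X ≋ turn₃ X
J⁻¹·₃ X p q 0F = J⁻¹-row₀ (X p q 0F) (X p q 1F)
J⁻¹·₃ X p q 1F = I-row₀ (X p q 0F) (X p q 1F)

J·₁-turn₁ : ∀ X → J ·₁ turn₁ X ≋ X
J·₁-turn₁ X 0F q r = I-row₁ (- X 1F q r) (X 0F q r)
J·₁-turn₁ X 1F q r = J-row₁ (X 1F q r) (X 0F q r)

J·₂-turn₂ : ∀ X → J ·₂ turn₂ X ≋ X
J·₂-turn₂ X p 0F r = I-row₁ (- X p 1F r) (X p 0F r)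
J·₂-turn₂ X p 1F r = J-row₁ (X p 1F r) (X p 0F r)

J·₃-turn₃ : ∀ X → J ·₃ turn₃ X ≋ X
J·₃-turn₃ X p q 0F = I-row₁ (- X p q 1F) (X p q 0F)
J·₃-turn₃ X p q 1F = J-row₁ (X p q 1F) (X p q 0F)

Unimodular-turn₁ : ∀ X → Unimodular X → Unimodular (turn₁ X)
Unimodular-turn₁ X dets =
  SectionDets-cong (≋-sym (≋-trans (act-along₁ J⁻¹ X) (J⁻¹·₁ X))) (Gen-Unimodular g₁⁻ dets)

Unimodular-turn₂ : ∀ X → Unimodular X → Unimodular (turn₂ X)
Unimodular-turn₂ X dets =
  SectionDets-cong (≋-sym (≋-trans (act-along₂ J⁻¹ X) (J⁻¹·₂ X))) (Gen-Unimodular g₂⁻ dets)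

Unimodular-turn₃ : ∀ X → Unimodular X → Unimodular (turn₃ X)
Unimodular-turn₃ X dets =
  SectionDets-cong (≋-sym (≋-trans (act-along₃ J⁻¹ X) (J⁻¹·₃ X))) (Gen-Unimodular g₃⁻ dets)

InOrbit-turn₁ : ∀ X → InOrbit (turn₁ X) → InOrbit X
InOrbit-turn₁ X = InOrbit-Gen g₁ (≋-sym (≋-trans (act-along₁ J (turn₁ X)) (J·₁-turn₁ X)))

InOrbit-turn₂ : ∀ X → InOrbit (turn₂ X) → InOrbit X
InOrbit-turn₂ X = InOrbit-Gen g₂ (≋-sym (≋-trans (act-along₂ J (turn₂ X)) (J·₂-turn₂ X)))

InOrbit-turn₃ : ∀ X → InOrbit (turn₃ X) → InOrbit X
InOrbit-turn₃ X = InOrbit-Gen g₃ (≋-sym (≋-trans (act-along₃ J (turn₃ X)) (J·₃-turn₃ X)))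

-- Signs of the entries of a unimodular cube

square≢-1 : ∀ t → t * t ≢ - + 1
square≢-1 (+ zero) ()
square≢-1 +[1+ n ] ()
square≢-1 -[1+ n ] ()

off-diagonal-product : ∀ M → det M ≡ + 1 → M 0F 0F ≡ + 0 → M 0F 1F * M 1F 0F ≡ - + 1
off-diagonal-product M det≡1 m₀₀≡0 = begin
  M 0F 1F * M 1F 0F                      ≡⟨ lemma (M 0F 1F * M 1F 0F) (M 1F 1F) ⟩
  - (+ 0 * M 1F 1F - M 0F 1F * M 1F 0F)  ≡⟨ cong (λ t → - (t * M 1F 1F - M 0F 1F * M 1F 0F)) m₀₀≡0 ⟨
  - det M                                ≡⟨ cong -_ det≡1 ⟩
  - + 1                                  ∎
  where
  open ≡-Reasoning
  lemma : ∀ p d → p ≡ - (+ 0 * d - p)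
  lemma = solve-∀

origin-nonzero : ∀ X → Unimodular X → X 0F 0F 0F ≢ + 0
origin-nonzero X dets a≡0 = square≢-1 (b * c * e) (begin
  b * c * e * (b * c * e)      ≡⟨ regroup b c e ⟩
  b * c * (b * e) * (c * e)    ≡⟨ cong₂ _*_ (cong₂ _*_ bc≡-1 be≡-1) ce≡-1 ⟩
  - + 1                        ∎)
  where
  open ≡-Reasoning
  b = X 0F 0F 1F
  c = X 0F 1F 0F
  e = X 1F 0F 0F
  bc≡-1 = off-diagonal-product (sec₁ X 0F) (sec₁-det dets 0F) a≡0
  be≡-1 = off-diagonal-product (sec₂ X 0F) (sec₂-det dets 0F) a≡0
  ce≡-1 = off-diagonal-product (sec₃ X 0F) (sec₃-det dets 0F) a≡0
  regroup : ∀ b c e → b * c * e * (b * c * e) ≡ b * c * (b * e) * (c * e)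
  regroup = solve-∀

edge-nonzero : ∀ X → Unimodular X → ∀ r → X 0F 0F r ≢ + 0
edge-nonzero X dets 0F = origin-nonzero X dets
edge-nonzero X dets 1F x≡0 = origin-nonzero (turn₃ X) (Unimodular-turn₃ X dets) (cong -_ x≡0)

face-nonzero : ∀ X → Unimodular X → ∀ q r → X 0F q r ≢ + 0
face-nonzero X dets 0F r = edge-nonzero X dets r
face-nonzero X dets 1F r x≡0 = edge-nonzero (turn₂ X) (Unimodular-turn₂ X dets) r (cong -_ x≡0)

entries-nonzero : ∀ X → Unimodular X → ∀ p q r → X p q r ≢ + 0
entries-nonzero X dets 0F q r = face-nonzero X dets q r
entries-nonzero X dets 1F q r x≡0 =
  face-nonzero (turn₁ X) (Unimodular-turn₁ X dets) q r (cong -_ x≡0)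

Pos Neg : ℤ → Set
Pos x = ∃ λ k → x ≡ +[1+ k ]
Neg x = ∃ λ k → x ≡ -[1+ k ]

Pos⊎Neg : ∀ {x} → x ≢ + 0 → Pos x ⊎ Neg x
Pos⊎Neg {+ zero}   x≢0 = ⊥-elim (x≢0 refl)
Pos⊎Neg {+[1+ k ]} _   = inj₁ (k , refl)
Pos⊎Neg { -[1+ k ]} _  = inj₂ (k , refl)

entry-sign : ∀ X → Unimodular X → ∀ p q r → Pos (X p q r) ⊎ Neg (X p q r)
entry-sign X dets p q r = Pos⊎Neg (entries-nonzero X dets p q r)

Neg⇒Pos-neg : ∀ {x} → Neg x → Pos (- x)
Neg⇒Pos-neg (k , refl) = k , refl

Pos⇒Pos-neg-neg : ∀ {x} → Pos x → Pos (- - x)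
Pos⇒Pos-neg-neg (k , refl) = k , refl

Pos-* : ∀ {x y} → Pos x → Pos y → Pos (x * y)
Pos-* (_ , refl) (_ , refl) = _ , refl

Neg-*-Pos : ∀ {x y} → Neg x → Pos y → Neg (x * y)
Neg-*-Pos (_ , refl) (_ , refl) = _ , refl

Pos-+ : ∀ {x y} → Pos x → Pos y → Pos (x + y)
Pos-+ (_ , refl) (_ , refl) = _ , refl

Pos⇒≢0 : ∀ {x} → Pos x → x ≢ + 0
Pos⇒≢0 (_ , refl) ()

det-Pos : ∀ M → det M ≡ + 1 → Pos (M 0F 0F) → Pos (M 0F 1F * M 1F 0F) → Pos (M 1F 1F)
det-Pos M = sign-rule
  where
  sign-rule : ∀ {x w p} → x * w - p ≡ + 1 → Pos x → Pos p → Pos w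
  sign-rule {w = +[1+ m ]} _ _ _ = m , refl
  sign-rule {w = + zero} e (k , refl) (l , refl)
    with trans (cong (_- +[1+ l ]) (sym (ℤ.*-zeroʳ +[1+ k ]))) e
  ... | ()
  sign-rule {w = -[1+ m ]} () (_ , refl) (_ , refl)

det-Neg : ∀ M → det M ≡ + 1 → M 1F 1F ≢ + 0 →
  Pos (M 0F 0F) → Neg (M 0F 1F * M 1F 0F) → Neg (M 1F 1F)
det-Neg M = sign-rule
  where
  sign-rule : ∀ {x w p} → x * w - p ≡ + 1 → w ≢ + 0 → Pos x → Neg p → Neg w
  sign-rule {w = -[1+ m ]} _ _ _ _ = m , refl
  sign-rule {w = + zero} _ w≢0 _ _ = ⊥-elim (w≢0 refl)
  sign-rule {w = +[1+ m ]} e _ (_ , refl) (_ , refl) =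
    ⊥-elim (ℕ.m+1+n≢0 _ (ℕ.suc-injective (ℤ.+-injective e)))

-- Cassini chains of positive integers

record CassiniChain (u v w z : ℕ) : Set where
  constructor chain
  field
    left  : u ℕ.* w ≡ suc (v ℕ.* v)
    right : v ℕ.* z ≡ suc (w ℕ.* w)

record FibWindow (x₀ x₁ x₂ x₃ : ℤ) : Set where
  constructor window
  field
    start : ℤ
    at₀   : x₀ ≡ oddFib start
    at₁   : x₁ ≡ oddFib (start + + 1)
    at₂   : x₂ ≡ oddFib (start + + 2)
    at₃   : x₃ ≡ oddFib (start + + 3)

cassini-ℕ⇒ℤ : ∀ u v w → u ℕ.* w ≡ suc (v ℕ.* v) → + u * + w ≡ + 1 + + v * + v
cassini-ℕ⇒ℤ u v w e =
  trans (sym (ℤ.pos-* u w)) (trans (cong +_ e) (cong (_+_ (+ 1)) (ℤ.pos-* v v)))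

cassini-ℤ⇒ℕ : ∀ u v w → + u * + w ≡ + 1 + + v * + v → u ℕ.* w ≡ suc (v ℕ.* v)
cassini-ℤ⇒ℕ u v w e =
  ℤ.+-injective (trans (ℤ.pos-* u w) (trans e (cong (_+_ (+ 1)) (sym (ℤ.pos-* v v)))))

chain-reverse : ∀ {u v w z} → CassiniChain u v w z → CassiniChain z w v u
chain-reverse {u} {v} {w} {z} (chain uw vz) =
  chain (trans (ℕ.*-comm z v) vz) (trans (ℕ.*-comm w u) uw)

chain-nonzero : ∀ {u v w z} → CassiniChain u v w z → ℕ.NonZero v
chain-nonzero {v = suc _} _ = _
chain-nonzero {v = zero} (chain _ ())

-- k = U Z - V W satisfies U + W = k V, so k U - V is the second root t of t V = U² + 1.
vieta-jump : ∀ U V W Z → U * W ≡ + 1 + V * V → V * Z ≡ + 1 + W * W →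
  ((U * Z - V * W) * U - V) * V ≡ + 1 + U * U
vieta-jump U V W Z uw vz = begin
  ((U * Z - V * W) * U - V) * V
    ≡⟨ identity U V W Z ⟩
  + 1 + U * U + U * U * (V * Z - (+ 1 + W * W)) + (U * W + + 1) * (U * W - (+ 1 + V * V))
    ≡⟨ cong₂ (λ s t → + 1 + U * U + U * U * s + (U * W + + 1) * t)
             (ℤ.i≡j⇒i-j≡0 vz) (ℤ.i≡j⇒i-j≡0 uw) ⟩
  + 1 + U * U + U * U * + 0 + (U * W + + 1) * + 0
    ≡⟨ solve (U ∷ W ∷ []) ⟩
  + 1 + U * U ∎
  where
  open ≡-Reasoning
  identity : ∀ U V W Z → ((U * Z - V * W) * U - V) * V
    ≡ + 1 + U * U + U * U * (V * Z - (+ 1 + W * W)) + (U * W + + 1) * (U * W - (+ 1 + V * V))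
  identity = solve-∀

vieta-root : ∀ {u v w z} → CassiniChain u v w z → ∃ λ t → t ℕ.* v ≡ suc (u ℕ.* u)
vieta-root {v = zero} (chain _ ())
vieta-root {u} {suc v} {w} {z} (chain uw vz) =
  natural ((+ u * + z - + suc v * + w) * + u - + suc v)
    (vieta-jump (+ u) (+ suc v) (+ w) (+ z)
      (cassini-ℕ⇒ℤ u (suc v) w uw) (cassini-ℕ⇒ℤ (suc v) w z vz))
  where
  natural : ∀ x → x * + suc v ≡ + 1 + + u * + u → ∃ λ t → t ℕ.* suc v ≡ suc (u ℕ.* u)
  natural (+ t) e = t , cassini-ℤ⇒ℕ t u (suc v) e
  natural -[1+ k ] e with trans e (cong (_+_ (+ 1)) (sym (ℤ.pos-* u u)))
  ... | ()

chain-extendˡ : ∀ {u v w z} → CassiniChain u v w z → ∃ λ t → CassiniChain t u v w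
chain-extendˡ c = map₂ (λ tv → chain tv (CassiniChain.left c)) (vieta-root c)

chain-extendʳ : ∀ {u v w z} → CassiniChain u v w z → ∃ λ t → CassiniChain v w z t
chain-extendʳ c = map₂ chain-reverse (chain-extendˡ (chain-reverse c))

window-from-left : ∀ {t u v w z} → FibWindow (+ t) (+ u) (+ v) (+ w) → CassiniChain u v w z →
  FibWindow (+ u) (+ v) (+ w) (+ z)
window-from-left {v = v} {w} {z} (window n _ u≡ v≡ w≡) c =
  window (n + + 1) u≡ (shift (+ 1) v≡) (shift (+ 2) w≡) (shift (+ 3) z≡)
  where
  open ≡-Reasoning
  shift : ∀ {x} k → x ≡ oddFib (n + (+ 1 + k)) → x ≡ oddFib (n + + 1 + k)
  shift k x≡ = trans x≡ (cong oddFib (sym (ℤ.+-assoc n (+ 1) k)))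
  z≡ : + z ≡ oddFib (n + + 4)
  z≡ = ℤ.*-cancelˡ-≡ (+ v) (+ z) (oddFib (n + + 4)) {{chain-nonzero c}} (begin
    + v * + z                               ≡⟨ cassini-ℕ⇒ℤ v w z (CassiniChain.right c) ⟩
    + 1 + + w * + w                         ≡⟨ cong (λ x → + 1 + x * x) w≡ ⟩
    + 1 + oddFib (n + + 3) * oddFib (n + + 3) ≡⟨ cassini⁺ n (+ 2) ⟨
    oddFib (n + + 2) * oddFib (n + + 4)     ≡⟨ cong (_* oddFib (n + + 4)) v≡ ⟨
    + v * oddFib (n + + 4)                  ∎)

window-from-right : ∀ {u v w z t} → FibWindow (+ v) (+ w) (+ z) (+ t) → CassiniChain u v w z →
  FibWindow (+ u) (+ v) (+ w) (+ z)
window-from-right {u} {v} {w} (window n v≡ w≡ z≡ _) c =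
  window (n - + 1) u≡ v≡′ (shift (+ 1) w≡) (shift (+ 2) z≡)
  where
  open ≡-Reasoning
  back : ∀ n k → n + k ≡ n - + 1 + (+ 1 + k)
  back = solve-∀
  shift : ∀ {x} k → x ≡ oddFib (n + k) → x ≡ oddFib (n - + 1 + (+ 1 + k))
  shift k x≡ = trans x≡ (cong oddFib (back n k))
  v≡′ : + v ≡ oddFib (n - + 1 + + 1)
  v≡′ = shift (+ 0) (trans v≡ (cong oddFib (sym (ℤ.+-identityʳ n))))
  u≡ : + u ≡ oddFib (n - + 1)
  u≡ = ℤ.*-cancelʳ-≡ (+ u) (oddFib (n - + 1)) (+ w) {{chain-nonzero (chain-reverse c)}} (begin
    + u * + w                                   ≡⟨ cassini-ℕ⇒ℤ u v w (CassiniChain.left c) ⟩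
    + 1 + + v * + v                             ≡⟨ cong (λ x → + 1 + x * x) v≡′ ⟩
    + 1 + oddFib (m + + 1) * oddFib (m + + 1)   ≡⟨ x-y≡1⇒x≡1+y _ _ (cassini m) ⟨
    oddFib m * oddFib (m + + 2)                 ≡⟨ cong (oddFib m *_) (shift (+ 1) w≡) ⟨
    oddFib m * + w                              ∎)
    where
    m = n - + 1

square-gap : ∀ v → suc (suc v ℕ.* suc v) ℕ.< suc (suc v) ℕ.* suc (suc v)
square-gap v = subst (suc (suc v ℕ.* suc v) ℕ.<_) (sym (expand v)) (ℕ.m<m+n _ ℕ.z<s)
  where
  expand : ∀ v → suc (suc v) ℕ.* suc (suc v) ≡ suc (suc v ℕ.* suc v) ℕ.+ suc (suc (v ℕ.+ v))
  expand = ℕ-Solver.solve-∀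

no-square-gap : ∀ {u v w} → ℕ.NonZero v → v ℕ.< w → w ℕ.≤ u → u ℕ.* w ≢ suc (v ℕ.* v)
no-square-gap {v = suc v} _ v<w w≤u uw =
  ℕ.<-irrefl (sym uw) (ℕ.<-≤-trans (square-gap v) (ℕ.*-mono-≤ (ℕ.≤-trans v<w w≤u) v<w))

-- v < w would give u w ≥ (v + 1)² > v² + 1, and w < v symmetrically; so v = w divides v² + 1.
chain-minimum : ∀ {u v w z} → w ℕ.≤ u → v ℕ.≤ z → CassiniChain u v w z →
  u ≡ 2 × v ≡ 1 × w ≡ 1 × z ≡ 2
chain-minimum {u} {v} {w} {z} w≤u v≤z c@(chain uw vz) with ℕ.<-cmp v w
... | tri< v<w _ _ = ⊥-elim (no-square-gap (chain-nonzero c) v<w w≤u uw)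
... | tri> _ _ w<v = ⊥-elim (no-square-gap (chain-nonzero (chain-reverse c)) w<v v≤z
                               (CassiniChain.left (chain-reverse c)))
... | tri≈ _ refl _ with ∣1⇒≡1 (∣m+n∣m⇒∣n (divides u (trans (ℕ.+-comm (v ℕ.* v) 1) (sym uw)))
                                           (n∣m*n v))
...   | refl = trans (sym (ℕ.*-identityʳ u)) uw , refl , refl , trans (sym (ℕ.*-identityˡ z)) vz

chain-base : ∀ {u v w z} → w ℕ.≤ u → v ℕ.≤ z → CassiniChain u v w z →
  FibWindow (+ u) (+ v) (+ w) (+ z)
chain-base w≤u v≤z c with chain-minimum w≤u v≤z c
... | refl , refl , refl , refl = window (+ 0) refl refl refl refl

-- Vieta jumping: if u < w the chain extends to the left, if z < v to the right, in both cases by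
-- a chain with smaller middle terms; otherwise it is the chain (2, 1, 1, 2).
chain-window : ∀ {u v w z} → CassiniChain u v w z → FibWindow (+ u) (+ v) (+ w) (+ z)
chain-window {v = v} {w} = <-rec P descend (v ℕ.+ w) refl
  where
  P : ℕ → Set
  P s = ∀ {u v w z} → v ℕ.+ w ≡ s → CassiniChain u v w z → FibWindow (+ u) (+ v) (+ w) (+ z)
  descend : ∀ s → (∀ {s′} → s′ ℕ.< s → P s′) → P s
  descend _ rec {u} {v} {w} {z} refl c with u ℕ.<? w | z ℕ.<? v
  ... | yes u<w | _ =
    window-from-left (rec (ℕ.<-≤-trans (ℕ.+-monoˡ-< v u<w) (ℕ.≤-reflexive (ℕ.+-comm w v))) refl
                          (proj₂ (chain-extendˡ c))) c
  ... | no _ | yes z<v =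
    window-from-right (rec (ℕ.<-≤-trans (ℕ.+-monoʳ-< w z<v) (ℕ.≤-reflexive (ℕ.+-comm w v))) refl
                           (proj₂ (chain-extendʳ c))) c
  ... | no u≮w | no z≮v = chain-base (ℕ.≮⇒≥ u≮w) (ℕ.≮⇒≥ z≮v) c

positive-window : ∀ a b d h → Pos a → Pos b → Pos d → Pos h →
  a * d - b * b ≡ + 1 → b * h - d * d ≡ + 1 → FibWindow a b d h
positive-window _ _ _ _ (a , refl) (b , refl) (d , refl) (h , refl) e₁ e₂ =
  chain-window (chain (cassini-ℤ⇒ℕ (suc a) (suc b) (suc d) (x-y≡1⇒x≡1+y (A * D) (B * B) e₁))
                      (cassini-ℤ⇒ℕ (suc b) (suc d) (suc h) (x-y≡1⇒x≡1+y (B * H) (D * D) e₂)))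
  where
  A = +[1+ a ]
  B = +[1+ b ]
  D = +[1+ d ]
  H = +[1+ h ]

-- Positive unimodular cubes

det-cancel : ∀ a x y s → a ≢ + 0 → a * x - s ≡ + 1 → a * y - s ≡ + 1 → x ≡ y
det-cancel a x y s a≢0 ex ey =
  ℤ.*-cancelˡ-≡ a x y {{≢-nonZero a≢0}}
    (trans (x-y≡1⇒x≡1+y (a * x) s ex) (sym (x-y≡1⇒x≡1+y (a * y) s ey)))

neighbours-equal : ∀ a b c d e f g h → a + d ≢ + 0 →
  a * f - b * e ≡ + 1 → a * g - c * e ≡ + 1 → c * h - d * g ≡ + 1 → b * h - d * f ≡ + 1 →
  b ≡ c
neighbours-equal a b c d e f g h a+d≢0 E₁ E₂ E₃ E₄ =
  sym (ℤ.i-j≡0⇒i≡j c b (begin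
    c - b                  ≡⟨ a[cf-bg]≡c-b ⟨
    a * (c * f - b * g)    ≡⟨ cong (a *_) cf-bg≡0 ⟩
    a * + 0                ≡⟨ ℤ.*-zeroʳ a ⟩
    + 0                    ∎))
  where
  open ≡-Reasoning
  a[cf-bg]≡c-b : a * (c * f - b * g) ≡ c - b
  a[cf-bg]≡c-b = begin
    a * (c * f - b * g)                        ≡⟨ identity a b c e f g ⟩
    c * (a * f - b * e) - b * (a * g - c * e)  ≡⟨ cong₂ (λ s t → c * s - b * t) E₁ E₂ ⟩
    c * + 1 - b * + 1                          ≡⟨ solve (b ∷ c ∷ []) ⟩
    c - b                                      ∎
    where
    identity : ∀ a b c e f g →
      a * (c * f - b * g) ≡ c * (a * f - b * e) - b * (a * g - c * e)
    identity = solve-∀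
  [a+d][cf-bg]≡0 : (a + d) * (c * f - b * g) ≡ + 0
  [a+d][cf-bg]≡0 = begin
    (a + d) * (c * f - b * g)
      ≡⟨ identity a b c d e f g h ⟩
    c * (a * f - b * e) - b * (a * g - c * e) + b * (c * h - d * g) - c * (b * h - d * f)
      ≡⟨ cong₂ _-_ (cong₂ _+_ (cong₂ _-_ (cong (c *_) E₁) (cong (b *_) E₂)) (cong (b *_) E₃))
                   (cong (c *_) E₄) ⟩
    c * + 1 - b * + 1 + b * + 1 - c * + 1
      ≡⟨ solve (b ∷ c ∷ []) ⟩
    + 0 ∎
    where
    identity : ∀ a b c d e f g h → (a + d) * (c * f - b * g)
      ≡ c * (a * f - b * e) - b * (a * g - c * e) + b * (c * h - d * g) - c * (b * h - d * f)
    identity = solve-∀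
  cf-bg≡0 : c * f - b * g ≡ + 0
  cf-bg≡0 = fromInj₂ (⊥-elim ∘ a+d≢0) (ℤ.i*j≡0⇒i≡0∨j≡0 (a + d) [a+d][cf-bg]≡0)

AllPositive : Cube → Set
AllPositive X = ∀ p q r → Pos (X p q r)

neighbours-positive : ∀ X → Unimodular X →
  Pos (X 0F 0F 0F) → Pos (X 0F 0F 1F) → Pos (X 0F 1F 0F) → Pos (X 1F 0F 0F) → AllPositive X
neighbours-positive X dets pa pb pc pe = positive
  where
  pd = det-Pos (sec₁ X 0F) (sec₁-det dets 0F) pa (Pos-* pb pc)
  pf = det-Pos (sec₂ X 0F) (sec₂-det dets 0F) pa (Pos-* pb pe)
  pg = det-Pos (sec₃ X 0F) (sec₃-det dets 0F) pa (Pos-* pc pe)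
  positive : AllPositive X
  positive 0F 0F 0F = pa
  positive 0F 0F 1F = pb
  positive 0F 1F 0F = pc
  positive 0F 1F 1F = pd
  positive 1F 0F 0F = pe
  positive 1F 0F 1F = pf
  positive 1F 1F 0F = pg
  positive 1F 1F 1F = det-Pos (sec₁ X 1F) (sec₁-det dets 1F) pe (Pos-* pf pg)

positive-symCube : ∀ X → Unimodular X → AllPositive X →
  ∃ λ n → X ≋ symCube (λ k → oddFib (n + k))
positive-symCube X dets pos = start , X≋symCube
  where
  a = X 0F 0F 0F
  b = X 0F 0F 1F
  c = X 0F 1F 0F
  d = X 0F 1F 1F
  e = X 1F 0F 0F
  f = X 1F 0F 1F
  g = X 1F 1F 0F
  h = X 1F 1F 1F
  b≡c : b ≡ c
  b≡c = neighbours-equal a b c d e f g h (Pos⇒≢0 (Pos-+ (pos 0F 0F 0F) (pos 0F 1F 1F)))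
    (sec₂-det dets 0F) (sec₃-det dets 0F) (sec₂-det dets 1F) (sec₃-det dets 1F)
  b≡e : b ≡ e
  b≡e = neighbours-equal a b e f c d g h (Pos⇒≢0 (Pos-+ (pos 0F 0F 0F) (pos 1F 0F 1F)))
    (sec₁-det dets 0F) (trans (cong (_-_ (a * g)) (ℤ.*-comm e c)) (sec₃-det dets 0F))
    (sec₁-det dets 1F) (trans (cong (_-_ (b * h)) (ℤ.*-comm f d)) (sec₃-det dets 1F))
  ad : a * d - b * b ≡ + 1
  ad = subst (λ t → a * d - b * t ≡ + 1) (sym b≡c) (sec₁-det dets 0F)
  d≡f : d ≡ f
  d≡f = det-cancel a d f (b * b) (Pos⇒≢0 (pos 0F 0F 0F)) ad
    (subst (λ t → a * f - b * t ≡ + 1) (sym b≡e) (sec₂-det dets 0F))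
  d≡g : d ≡ g
  d≡g = det-cancel a d g (b * b) (Pos⇒≢0 (pos 0F 0F 0F)) ad
    (subst₂ (λ s t → a * g - s * t ≡ + 1) (sym b≡c) (sym b≡e) (sec₃-det dets 0F))
  bh : b * h - d * d ≡ + 1
  bh = subst (λ t → b * h - d * t ≡ + 1) (sym d≡f) (sec₃-det dets 1F)
  open FibWindow
    (positive-window a b d h (pos 0F 0F 0F) (pos 0F 0F 1F) (pos 0F 1F 1F) (pos 1F 1F 1F) ad bh)
  X≋symCube : X ≋ symCube (λ k → oddFib (start + k))
  X≋symCube 0F 0F 0F = trans at₀ (cong oddFib (sym (ℤ.+-identityʳ start)))
  X≋symCube 0F 0F 1F = at₁
  X≋symCube 0F 1F 0F = trans (sym b≡c) at₁
  X≋symCube 0F 1F 1F = at₂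
  X≋symCube 1F 0F 0F = trans (sym b≡e) at₁
  X≋symCube 1F 0F 1F = trans (sym d≡f) at₂
  X≋symCube 1F 1F 0F = trans (sym d≡g) at₂
  X≋symCube 1F 1F 1F = at₃

symCube-InOrbit : ∀ X n → X ≋ symCube (λ k → oddFib (n + k)) → InOrbit X
symCube-InOrbit X n X≋symCube =
  n , (I , I , I) , idH ,
  ≋-trans X≋symCube (≋-trans (≋-sym (cubeA-symCube n)) (≋-sym (act-identity (cubeA n))))

InOrbit-positive : ∀ X → Unimodular X → AllPositive X → InOrbit X
InOrbit-positive X dets pos = uncurry (symCube-InOrbit X) (positive-symCube X dets pos)

-- Making a unimodular cube positive

-- If X₀₀₁ < 0, the faces through the origin force X₀₁₁ < 0 and X₁₀₁ < 0, so turn₃ makes the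
-- origin and its three neighbours positive.
InOrbit-turning₃ : ∀ X → Unimodular X → Pos (X 0F 0F 0F) → Pos (X 0F 1F 0F) → Pos (X 1F 0F 0F) →
  Pos (X 0F 0F 1F) ⊎ Neg (X 0F 0F 1F) → InOrbit X
InOrbit-turning₃ X dets pa pc pe (inj₁ pb) =
  InOrbit-positive X dets (neighbours-positive X dets pa pb pc pe)
InOrbit-turning₃ X dets pa pc pe (inj₂ nb) =
  InOrbit-turn₃ X (InOrbit-positive (turn₃ X) dets₃
    (neighbours-positive (turn₃ X) dets₃ (Neg⇒Pos-neg nb) pa (Neg⇒Pos-neg nd) (Neg⇒Pos-neg nf)))
  where
  dets₃ = Unimodular-turn₃ X dets
  nd = det-Neg (sec₁ X 0F) (sec₁-det dets 0F) (entries-nonzero X dets 0F 1F 1F) pa (Neg-*-Pos nb pc)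
  nf = det-Neg (sec₂ X 0F) (sec₂-det dets 0F) (entries-nonzero X dets 1F 0F 1F) pa (Neg-*-Pos nb pe)

-- If X₀₁₀ < 0, the face r = 0 forces X₁₁₀ < 0, so after turn₂ the entries X₀₀₀, X₀₁₀, X₁₀₀
-- are positive.
InOrbit-turning₂ : ∀ X → Unimodular X → Pos (X 0F 0F 0F) → Pos (X 1F 0F 0F) →
  Pos (X 0F 1F 0F) ⊎ Neg (X 0F 1F 0F) → InOrbit X
InOrbit-turning₂ X dets pa pe (inj₁ pc) =
  InOrbit-turning₃ X dets pa pc pe (entry-sign X dets 0F 0F 1F)
InOrbit-turning₂ X dets pa pe (inj₂ nc) =
  InOrbit-turn₂ X (InOrbit-turning₃ (turn₂ X) dets₂ (Neg⇒Pos-neg nc) pa (Neg⇒Pos-neg ng)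
                    (entry-sign (turn₂ X) dets₂ 0F 0F 1F))
  where
  dets₂ = Unimodular-turn₂ X dets
  ng = det-Neg (sec₃ X 0F) (sec₃-det dets 0F) (entries-nonzero X dets 1F 1F 0F) pa (Neg-*-Pos nc pe)

InOrbit-turned₁ : ∀ X → Unimodular X → Pos (- X 1F 0F 0F) → Pos (X 0F 0F 0F) → InOrbit X
InOrbit-turned₁ X dets p q =
  InOrbit-turn₁ X (InOrbit-turning₂ (turn₁ X) dets₁ p q (entry-sign (turn₁ X) dets₁ 0F 1F 0F))
  where
  dets₁ = Unimodular-turn₁ X dets

-- turn₁ sends the signs of (X₀₀₀, X₁₀₀) to those of (- X₁₀₀, X₀₀₀), so at most three turns make
-- both positive.
InOrbit-turning₁ : ∀ X → Unimodular X →
  Pos (X 0F 0F 0F) ⊎ Neg (X 0F 0F 0F) → Pos (X 1F 0F 0F) ⊎ Neg (X 1F 0F 0F) → InOrbit X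
InOrbit-turning₁ X dets (inj₁ pa) (inj₁ pe) =
  InOrbit-turning₂ X dets pa pe (entry-sign X dets 0F 1F 0F)
InOrbit-turning₁ X dets (inj₁ pa) (inj₂ ne) = InOrbit-turned₁ X dets (Neg⇒Pos-neg ne) pa
InOrbit-turning₁ X dets (inj₂ na) (inj₂ ne) =
  InOrbit-turn₁ X
    (InOrbit-turned₁ (turn₁ X) (Unimodular-turn₁ X dets) (Neg⇒Pos-neg na) (Neg⇒Pos-neg ne))
InOrbit-turning₁ X dets (inj₂ na) (inj₁ pe) =
  InOrbit-turn₁ X (InOrbit-turn₁ (turn₁ X)
    (InOrbit-turned₁ (turn₁ (turn₁ X)) (Unimodular-turn₁ (turn₁ X) (Unimodular-turn₁ X dets))
      (Pos⇒Pos-neg-neg pe) (Neg⇒Pos-neg na)))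

Unimodular⇒InOrbit : ∀ X → Unimodular X → InOrbit X
Unimodular⇒InOrbit X dets =
  InOrbit-turning₁ X dets (entry-sign X dets 0F 0F 0F) (entry-sign X dets 1F 0F 0F)

theorem10p3 : (A : Cube) →
    AllDetsOne A ⇔ Σ ℤ (λ n → Σ Triple (λ h → InH h × (A ≋ act h (cubeA n))))
theorem10p3 A = mk⇔
  (Unimodular⇒InOrbit A ∘ AllDetsOne⇒Unimodular)
  (Unimodular⇒AllDetsOne ∘ InOrbit⇒Unimodular A)
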